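{- Let $c$ be a sorting network on $n$ channels. Then for every channel $i\in\{1,\dots,n\}$, the pruned comparator network $c/i$ on $n-1$ channels is a sorting network.
   Context: $B=\{0,1\}$. A comparator $[i,j]$ replaces $x_i$ by $\min(x_i,x_j)$ and $x_j$ by $\max(x_i,x_j)$; an exchange $(i,j)$ swaps entries $i,j$. A comparator network is a finite sequence of comparators and exchanges applied left to right; it is a sorting network on $n$ channels if its output on every input in $B^n$ (equivalently, by the zero-one principle, on every input over any totally ordered set) is sorted. Every comparator network on $n$ channels corresponds to a comparator circuit: $n$ ordered inputs and $n$ ordered outputs, built from comparator gates (two unlabeled inputs, outputs labeled min and max), acyclic, each port connected to exactly one other port; the comparators are the gates and exchanges are absorbed into the wiring; conversely every such circuit is realized by a comparator network with the same number of comparators and the same input-output behaviour. Pruning: given the circuit of $c$ and input $i$, consider the path starting at input $i$ that at every gate it enters leaves via that gate's max output, ending at some output $j$. Delete the wires of this path; each gate on the path is then left with one incoming and one outgoing wire, and is removed and replaced by a wire directly connecting those two ports. Finally delete the isolated input $i$ and output $j$, keeping the order of the remaining inputs and outputs. The resulting circuit on $n-1$ channels, viewed as a comparator network, is $c/i$. -}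

module Defs where

open import Data.Nat using (ℕ; zero; suc)
open import Data.Fin using (Fin; zero; suc; punchOut; _≟_)
import Data.Fin as F
open import Data.Fin.Properties using (punchOut-injective)
open import Data.Bool using (Bool; true; false; _∧_; _∨_; if_then_else_)
import Data.Bool as B
open import Data.List using (List; []; _∷_; map; _++_; [_])
open import Relation.Nullary using (yes; no; does)
open import Relation.Binary.PropositionalEquality using (_≡_; _≢_; refl; sym; subst)

data Op (n : ℕ) : Set where
  cmp : (i j : Fin n) → i ≢ j → Op n
  xch : (i j : Fin n) → Op n

Network : ℕ → Set
Network n = List (Op n)

-- Inputs in B^n, with B = {0,1} = Bool (false = 0 < true = 1);
-- min = ∧, max = ∨.
Input : ℕ → Set
Input n = Fin n → Bool

step : ∀ {n} → Op n → Input n → Input n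
step (cmp i j _) x k =
  if does (k ≟ i) then x i ∧ x j
  else if does (k ≟ j) then x i ∨ x j
  else x k
step (xch i j) x k =
  if does (k ≟ i) then x j
  else if does (k ≟ j) then x i
  else x k

run : ∀ {n} → Network n → Input n → Input n
run []       x = x
run (o ∷ os) x = run os (step o x)

Sorted : ∀ {n} → Input n → Set
Sorted {n} y = (a b : Fin n) → a F.≤ b → y a B.≤ y b

IsSortingNetwork : ∀ {n} → Network n → Set
IsSortingNetwork {n} c = (x : Input n) → Sorted (run c x)

-- We follow the max-path of input i through the network.  At any time the
-- path occupies a channel p (the "hole"); the remaining n-1 wires are
-- the channels k ≠ p, numbered in order by punchOut p k.  This is exactly
-- the order of the remaining inputs at the start (hole = i) and of the
-- remaining outputs at the end (hole = j).
--
--  * comparator [a,b] with a,b ≠ p: kept (channels renumbered).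
--  * comparator [p,b]: the path leaves via the max output, on channel b;
--    the gate is replaced by a wire from its other input (on channel b)
--    to its min output (on channel p).  So the hole moves to b and the
--    value on b moves to channel p.
--  * comparator [a,p]: the path leaves via max on channel p; the other
--    input (channel a) is wired to the min output (channel a): nothing.
--  * exchange (a,b): pure wiring; the hole moves along with it.
-- When the hole moves from p to b the renumbering of the n-1 remaining
-- wires changes by a rotation; this rotation is realised by the exchange
-- sequence `move s t`, which moves the entry at position s to position t
-- shifting the entries in between by one (adjacent exchanges).

liftOp : ∀ {m} → Op m → Op (suc m)
liftOp (cmp i j i≢j) = cmp (suc i) (suc j) (λ e → i≢j (F.suc-injective e))
  where import Data.Fin.Properties as F
liftOp (xch i j)     = xch (suc i) (suc j)

move : ∀ {m} → Fin m → Fin m → List (Op m)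
move zero    zero    = []
move {suc (suc m)} zero (suc t) = xch zero (suc zero) ∷ map liftOp (move zero t)
move {suc (suc m)} (suc s) zero = map liftOp (move s zero) ++ [ xch zero (suc zero) ]
move (suc s) (suc t) = map liftOp (move s t)

-- the hole moves from p to b ≠ p, value on b moves to channel p
moveHole : ∀ {m} (p b : Fin (suc m)) → p ≢ b → List (Op m)
moveHole p b p≢b = move (punchOut p≢b) (punchOut (λ e → p≢b (sym e)))

pruneFrom : ∀ {m} → Fin (suc m) → Network (suc m) → Network m
pruneFrom p [] = []
pruneFrom p (cmp a b a≢b ∷ os) with a ≟ p | b ≟ p
... | yes a≡p | _ =
  moveHole p b (λ p≡b → a≢b (subst (a ≡_) p≡b a≡p)) ++ pruneFrom b os
... | no _ | yes _ = pruneFrom p os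
... | no a≢p | no b≢p =
  cmp (punchOut p≢a) (punchOut p≢b)
      (λ e → a≢b (punchOut-injective p≢a p≢b e)) ∷ pruneFrom p os
  where
  p≢a : p ≢ a
  p≢a e = a≢p (sym e)
  p≢b : p ≢ b
  p≢b e = b≢p (sym e)
pruneFrom p (xch a b ∷ os) with a ≟ b | a ≟ p | b ≟ p
... | yes _ | _ | _ = pruneFrom p os
... | no a≢b | yes a≡p | _ =
  moveHole p b (λ p≡b → a≢b (subst (a ≡_) p≡b a≡p)) ++ pruneFrom b os
... | no a≢b | no _ | yes b≡p =
  moveHole p a (λ p≡a → a≢b (subst (_≡ b) p≡a (sym b≡p))) ++ pruneFrom a os
... | no _ | no a≢p | no b≢p =
  xch (punchOut (λ e → a≢p (sym e))) (punchOut (λ e → b≢p (sym e))) ∷ pruneFrom p os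

prune : ∀ {m} → Network (suc m) → Fin (suc m) → Network m
prune c i = pruneFrom i c

{-# OPTIONS --safe #-}
-- Feed c/i an arbitrary 0-1 input y, and feed c the input obtained from y by
-- inserting a 1 on channel i.  Since max(1, v) = 1 and min(1, v) = v, this 1
-- travels exactly along the max-path of input i, and every other wire of c
-- carries the same value as the corresponding wire of c/i.  Hence the output
-- of c/i is the sorted output of c with one entry deleted, so it is sorted.
module Submission where

open import Defs
open import Data.Nat as ℕ using (ℕ; suc)
open import Data.Fin using (Fin; zero; suc; punchOut; punchIn; _≟_)
open import Data.Fin.Properties
  using (punchOut-cong; punchOut-injective; punchIn-punchOut; punchOut-punchIn; punchInᵢ≢i; punchIn-mono-≤)
open import Data.Bool using (true; _∧_; _∨_)
import Data.Bool as B
open import Data.Bool.Properties using (∧-identityʳ; ∨-zeroʳ)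
open import Data.List using ([]; _∷_; map; _++_; [_])
open import Data.Vec.Functional using (insertAt)
open import Data.Vec.Functional.Properties using (insertAt-lookup; insertAt-punchIn)
open import Data.Product using (_,_; ∃-syntax)
open import Function using (_∘_; flip)
open import Relation.Nullary using (does; yes; no; contradiction)
open import Relation.Nullary.Decidable using (dec-true; dec-false)
open import Relation.Binary.PropositionalEquality
  using (_≡_; _≢_; _≗_; refl; sym; trans; cong; cong-app; subst; subst₂; module ≡-Reasoning)

open ≡-Reasoning

private
  variable
    m n : ℕ

run-++ : (c d : Network n) (x : Input n) → run (c ++ d) x ≡ run d (run c x)
run-++ []      d x = refl
run-++ (o ∷ c) d x = run-++ c d (step o x)

run-map-liftOp-zero : (c : Network n) (x : Input (suc n)) → run (map liftOp c) x zero ≡ x zero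
run-map-liftOp-zero []                   x = refl
run-map-liftOp-zero (cmp i j i≢j ∷ c) x = run-map-liftOp-zero c _
run-map-liftOp-zero (xch i j ∷ c)     x = run-map-liftOp-zero c _

run-map-liftOp-suc : (c : Network n) (x : Input (suc n)) (k : Fin n) →
                     run (map liftOp c) x (suc k) ≡ run c (x ∘ suc) k
run-map-liftOp-suc []                x k = refl
run-map-liftOp-suc (cmp i j i≢j ∷ c) x k = run-map-liftOp-suc c _ k
run-map-liftOp-suc (xch i j ∷ c)     x k = run-map-liftOp-suc c _ k

run-move-target : (s t : Fin (suc n)) (y : Input (suc n)) → run (move s t) y t ≡ y s
run-move-target zero    zero    y = refl
run-move-target {suc n} zero    (suc t) y =
  trans (run-map-liftOp-suc (move zero t) _ t) (run-move-target zero t _)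
run-move-target {suc n} (suc s) zero    y =
  trans (cong-app (run-++ (map liftOp (move s zero)) [ xch zero (suc zero) ] y) _)
        (trans (run-map-liftOp-suc (move s zero) y zero) (run-move-target s zero _))
run-move-target {suc n} (suc s) (suc t) y =
  trans (run-map-liftOp-suc (move s t) y t) (run-move-target s t _)

run-move-punchIn : (s t : Fin (suc n)) (y : Input (suc n)) (j : Fin n) →
                   run (move s t) y (punchIn t j) ≡ y (punchIn s j)
run-move-punchIn zero zero y j = refl
run-move-punchIn {suc n} zero (suc t) y zero = run-map-liftOp-zero (move zero t) _
run-move-punchIn {suc n} zero (suc t) y (suc j) =
  trans (run-map-liftOp-suc (move zero t) _ (punchIn t j)) (run-move-punchIn zero t _ j)
run-move-punchIn {suc n} (suc s) zero y zero =
  trans (cong-app (run-++ (map liftOp (move s zero)) [ xch zero (suc zero) ] y) _)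
        (run-map-liftOp-zero (move s zero) y)
run-move-punchIn {suc n} (suc s) zero y (suc j) =
  trans (cong-app (run-++ (map liftOp (move s zero)) [ xch zero (suc zero) ] y) _)
        (trans (run-map-liftOp-suc (move s zero) y (suc j)) (run-move-punchIn s zero _ j))
run-move-punchIn {suc n} (suc s) (suc t) y zero = run-map-liftOp-zero (move s t) y
run-move-punchIn {suc n} (suc s) (suc t) y (suc j) =
  trans (run-map-liftOp-suc (move s t) y (punchIn t j)) (run-move-punchIn s t _ j)

-- Both sides enumerate the channels other than p and b in increasing order.
punchIn-punchIn-comm : {p b : Fin (suc (suc m))} (p≢b : p ≢ b) (j : Fin m) →
                       punchIn b (punchIn (punchOut (p≢b ∘ sym)) j) ≡ punchIn p (punchIn (punchOut p≢b) j)
punchIn-punchIn-comm {p = zero}  {zero}  p≢b j = contradiction refl p≢b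
punchIn-punchIn-comm {p = zero}  {suc b} p≢b j = refl
punchIn-punchIn-comm {p = suc p} {zero}  p≢b j = refl
punchIn-punchIn-comm {p = suc p} {suc b} p≢b zero    = refl
punchIn-punchIn-comm {p = suc p} {suc b} p≢b (suc j) =
  cong suc (punchIn-punchIn-comm (p≢b ∘ cong suc) j)

punchIn-≟-punchOut : {p a : Fin (suc n)} (p≢a : p ≢ a) (j : Fin n) →
                     does (punchIn p j ≟ a) ≡ does (j ≟ punchOut p≢a)
punchIn-≟-punchOut {p = p} p≢a j with j ≟ punchOut p≢a
... | yes refl = dec-true (punchIn p j ≟ _) (punchIn-punchOut p≢a)
... | no j≢a′  = dec-false (punchIn p j ≟ _)
                   (λ e → j≢a′ (trans (sym (punchOut-punchIn p)) (punchOut-cong p e)))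

module _ (x : Input n) (i j : Fin n) where

  step-cmp-min : (i≢j : i ≢ j) → step (cmp i j i≢j) x i ≡ x i ∧ x j
  step-cmp-min i≢j rewrite dec-true (i ≟ i) refl = refl

  step-cmp-max : (i≢j : i ≢ j) → step (cmp i j i≢j) x j ≡ x i ∨ x j
  step-cmp-max i≢j rewrite dec-false (j ≟ i) (i≢j ∘ sym) | dec-true (j ≟ j) refl = refl

  step-cmp-other : (i≢j : i ≢ j) {k : Fin n} → i ≢ k → j ≢ k → step (cmp i j i≢j) x k ≡ x k
  step-cmp-other i≢j {k} i≢k j≢k
    rewrite dec-false (k ≟ i) (i≢k ∘ sym) | dec-false (k ≟ j) (j≢k ∘ sym) = refl

  step-xch-left : step (xch i j) x i ≡ x j
  step-xch-left rewrite dec-true (i ≟ i) refl = refl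

  step-xch-right : i ≢ j → step (xch i j) x j ≡ x i
  step-xch-right i≢j rewrite dec-false (j ≟ i) (i≢j ∘ sym) | dec-true (j ≟ j) refl = refl

  step-xch-other : {k : Fin n} → i ≢ k → j ≢ k → step (xch i j) x k ≡ x k
  step-xch-other {k} i≢k j≢k
    rewrite dec-false (k ≟ i) (i≢k ∘ sym) | dec-false (k ≟ j) (j≢k ∘ sym) = refl

  step-cmp-max-true : (i≢j : i ≢ j) → x j ≡ true → step (cmp i j i≢j) x ≗ x
  step-cmp-max-true i≢j xj≡1 k with k ≟ i | k ≟ j
  ... | yes refl | _        = trans (cong (x k ∧_) xj≡1) (∧-identityʳ (x k))
  ... | no _     | yes refl = trans (cong (x i ∨_) xj≡1) (trans (∨-zeroʳ (x i)) (sym xj≡1))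
  ... | no _     | no _     = refl

step-xch-self : (i : Fin n) (x : Input n) → step (xch i i) x ≗ x
step-xch-self i x k with k ≟ i
... | yes refl = refl
... | no _     = refl

-- x ≗ insertAt y p true; the 1 on channel p marks the max-path.
record HoleAt (p : Fin (suc n)) (x : Input (suc n)) (y : Input n) : Set where
  field
    hole : x p ≡ true
    rest : ∀ j → x (punchIn p j) ≡ y j

  rest-punchOut : {a : Fin (suc n)} (p≢a : p ≢ a) → x a ≡ y (punchOut p≢a)
  rest-punchOut p≢a = trans (cong x (sym (punchIn-punchOut p≢a))) (rest (punchOut p≢a))

open HoleAt

insertAt-HoleAt : (y : Input n) (p : Fin (suc n)) → HoleAt p (insertAt y p true) y
insertAt-HoleAt y p = record { hole = insertAt-lookup y p true ; rest = insertAt-punchIn y p true }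

HoleAt-sorted : {p : Fin (suc n)} {x : Input (suc n)} {y : Input n} → HoleAt p x y → Sorted x → Sorted y
HoleAt-sorted {p = p} h x-sorted a b a≤b =
  subst₂ B._≤_ (rest h a) (rest h b) (x-sorted (punchIn p a) (punchIn p b) (punchIn-mono-≤ p a b a≤b))

module _ {p : Fin (suc n)} {x : Input (suc n)} {y : Input n} (h : HoleAt p x y) where

  HoleAt-≗ : {x′ : Input (suc n)} → x′ ≗ x → HoleAt p x′ y
  hole (HoleAt-≗ x′≗x) = trans (x′≗x p) (hole h)
  rest (HoleAt-≗ x′≗x) j = trans (x′≗x _) (rest h j)

  HoleAt-cmp : {a b : Fin (suc n)} (a≢b : a ≢ b) (p≢a : p ≢ a) (p≢b : p ≢ b)
               (a≢b′ : punchOut p≢a ≢ punchOut p≢b) →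
               HoleAt p (step (cmp a b a≢b) x) (step (cmp (punchOut p≢a) (punchOut p≢b) a≢b′) y)
  hole (HoleAt-cmp a≢b p≢a p≢b a≢b′) = trans (step-cmp-other x _ _ a≢b (p≢a ∘ sym) (p≢b ∘ sym)) (hole h)
  rest (HoleAt-cmp a≢b p≢a p≢b a≢b′) j
    rewrite punchIn-≟-punchOut p≢a j | punchIn-≟-punchOut p≢b j
          | rest-punchOut h p≢a | rest-punchOut h p≢b | rest h j = refl

  HoleAt-xch : {a b : Fin (suc n)} (p≢a : p ≢ a) (p≢b : p ≢ b) →
               HoleAt p (step (xch a b) x) (step (xch (punchOut p≢a) (punchOut p≢b)) y)
  hole (HoleAt-xch {a} {b} p≢a p≢b) = trans (step-xch-other x a b (p≢a ∘ sym) (p≢b ∘ sym)) (hole h)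
  rest (HoleAt-xch p≢a p≢b) j
    rewrite punchIn-≟-punchOut p≢a j | punchIn-≟-punchOut p≢b j
          | rest-punchOut h p≢a | rest-punchOut h p≢b | rest h j = refl

HoleAt-moveHole : {p b : Fin (suc n)} {x x′ : Input (suc n)} {y : Input n} →
                  HoleAt p x y → (p≢b : p ≢ b) →
                  x′ b ≡ true → x′ p ≡ x b → (∀ {k} → p ≢ k → b ≢ k → x′ k ≡ x k) →
                  HoleAt b x′ (run (moveHole p b p≢b) y)
HoleAt-moveHole {ℕ.zero} {zero} {zero} h p≢b = contradiction refl p≢b
hole (HoleAt-moveHole {suc n} h p≢b x′b≡1 x′p≡xb x′≡x) = x′b≡1
rest (HoleAt-moveHole {suc n} {p} {b} {x} {x′} {y} h p≢b x′b≡1 x′p≡xb x′≡x) j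
  with j ≟ punchOut (p≢b ∘ sym)
... | yes refl = begin
  x′ (punchIn b t)          ≡⟨ cong x′ (punchIn-punchOut (p≢b ∘ sym)) ⟩
  x′ p                      ≡⟨ x′p≡xb ⟩
  x b                       ≡⟨ rest-punchOut h p≢b ⟩
  y s                       ≡⟨ run-move-target s t y ⟨
  run (move s t) y t        ∎
  where s = punchOut p≢b
        t = punchOut (p≢b ∘ sym)
... | no j≢t = begin
  x′ (punchIn b j)                  ≡⟨ cong x′ (trans (cong (punchIn b) j≡t↑j₀) commute) ⟩
  x′ (punchIn p (punchIn s j₀))     ≡⟨ x′≡x (punchInᵢ≢i p _ ∘ sym) b≢k ⟩
  x (punchIn p (punchIn s j₀))      ≡⟨ rest h _ ⟩
  y (punchIn s j₀)                  ≡⟨ run-move-punchIn s t y j₀ ⟨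
  run (move s t) y (punchIn t j₀)   ≡⟨ cong (run (move s t) y) j≡t↑j₀ ⟨
  run (move s t) y j                ∎
  where
  s = punchOut p≢b
  t = punchOut (p≢b ∘ sym)
  j₀ = punchOut (j≢t ∘ sym)
  j≡t↑j₀ : j ≡ punchIn t j₀
  j≡t↑j₀ = sym (punchIn-punchOut (j≢t ∘ sym))
  commute : punchIn b (punchIn t j₀) ≡ punchIn p (punchIn s j₀)
  commute = punchIn-punchIn-comm p≢b j₀
  b≢k : b ≢ punchIn p (punchIn s j₀)
  b≢k e = punchInᵢ≢i b (punchIn t j₀) (trans commute (sym e))

pruneFrom-simulates : (c : Network (suc n)) {p : Fin (suc n)} {x : Input (suc n)} {y : Input n} →
                      HoleAt p x y → ∃[ q ] HoleAt q (run c x) (run (pruneFrom p c) y)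

pruneFrom-simulates-after : (ms : Network n) (c : Network (suc n))
                            {b : Fin (suc n)} {x : Input (suc n)} {y : Input n} → HoleAt b x (run ms y) →
                            ∃[ q ] HoleAt q (run c x) (run (ms ++ pruneFrom b c) y)
pruneFrom-simulates-after ms c {b} {y = y} h
  rewrite run-++ ms (pruneFrom b c) y = pruneFrom-simulates c h

pruneFrom-simulates [] h = _ , h
pruneFrom-simulates (cmp a b a≢b ∷ c) {p} {x} h with a ≟ p | b ≟ p
... | yes refl | _ = pruneFrom-simulates-after (moveHole a b a≢b′) c (HoleAt-moveHole h a≢b′
        (trans (step-cmp-max x a b a≢b) (cong (_∨ x b) (hole h)))
        (trans (step-cmp-min x a b a≢b) (cong (_∧ x b) (hole h)))
        (step-cmp-other x a b a≢b))
  where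
  -- literally the proof built by pruneFrom, so that the exchange sequences agree
  a≢b′ : a ≢ b
  a≢b′ a≡b = a≢b (subst (a ≡_) a≡b refl)
... | no _ | yes refl = pruneFrom-simulates c (HoleAt-≗ h (step-cmp-max-true x a b a≢b (hole h)))
... | no a≢p | no b≢p = pruneFrom-simulates c (HoleAt-cmp h a≢b (a≢p ∘ sym) (b≢p ∘ sym)
                                (a≢b ∘ punchOut-injective (a≢p ∘ sym) (b≢p ∘ sym)))
pruneFrom-simulates (xch a b ∷ c) {p} {x} h with a ≟ b | a ≟ p | b ≟ p
... | yes refl | _ | _ = pruneFrom-simulates c (HoleAt-≗ h (step-xch-self a x))
... | no a≢b | yes refl | _ = pruneFrom-simulates-after (moveHole a b a≢b′) c (HoleAt-moveHole h a≢b′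
        (trans (step-xch-right x a b a≢b) (hole h)) (step-xch-left x a b) (step-xch-other x a b))
  where
  a≢b′ : a ≢ b
  a≢b′ a≡b = a≢b (subst (a ≡_) a≡b refl)
... | no a≢b | no a≢p | yes refl = pruneFrom-simulates-after (moveHole b a b≢a′) c (HoleAt-moveHole h b≢a′
        (trans (step-xch-left x a b) (hole h)) (step-xch-right x a b a≢b) (flip (step-xch-other x a b)))
  where
  b≢a′ : b ≢ a
  b≢a′ b≡a = a≢b (subst (_≡ b) b≡a refl)
... | no _ | no a≢p | no b≢p = pruneFrom-simulates c (HoleAt-xch h (a≢p ∘ sym) (b≢p ∘ sym))

mainTheorem8 : ∀ {m : ℕ} (c : Network (suc m)) → IsSortingNetwork c →
                 (i : Fin (suc m)) → IsSortingNetwork (prune c i)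
mainTheorem8 c c-sorts i y =
  let _ , h = pruneFrom-simulates c (insertAt-HoleAt y i) in
  HoleAt-sorted h (c-sorts (insertAt y i true))
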